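{- Let $a,b\geq 0$ and $g\geq 3$ be integers. Then $n(a,b,g)\geq a+b+1$. Moreover, if $ab$ is odd, then $n(a,b,g)\geq a+b+2$.
   Context: A weighted graph (wgraph) is a pair $G=(L,H)$ of simple finite graphs with $V(L)=V(H)$ and $E(L)\cap E(H)=\varnothing$; edges of $L$ are light (weight 1) and edges of $H$ are heavy (weight 2). A wcycle is a cycle (of length at least 3) in the graph with edge set $E(L)\cup E(H)$; its weight is the sum of the weights of its edges. The girth of $G$ is the minimum weight of a wcycle. $G$ is $(a,b)$-regular if $L$ is $a$-regular and $H$ is $b$-regular. An $(a,b,g)$-wgraph is an $(a,b)$-regular wgraph of girth $g$; $n(a,b,g)$ is the minimum order of an $(a,b,g)$-wgraph ($\infty$ if none exists). -}

module Defs where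

open import Data.Nat using (ℕ; zero; suc; _+_; _≤_)
open import Data.Fin using (Fin; zero; suc)
open import Data.Bool using (Bool; true; false; if_then_else_)
open import Data.List using (List; map; allFin)
open import Data.Nat.ListAction using (sum)
open import Data.Product using (Σ; _×_)
open import Relation.Binary.PropositionalEquality using (_≡_)

-- A weighted graph on vertex set Fin n: light graph L and heavy graph H,
-- both simple (symmetric, irreflexive), with disjoint edge sets.
record WGraph (n : ℕ) : Set where
  field
    L     : Fin n → Fin n → Bool
    H     : Fin n → Fin n → Bool
    L-sym : ∀ i j → L i j ≡ L j i
    H-sym : ∀ i j → H i j ≡ H j i
    L-irr : ∀ i → L i i ≡ false
    H-irr : ∀ i → H i i ≡ false
    disj  : ∀ i j → L i j ≡ true → H i j ≡ false

open WGraph public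

degree : ∀ {n} → (Fin n → Fin n → Bool) → Fin n → ℕ
degree {n} R i = sum (map (λ j → if R i j then 1 else 0) (allFin n))

Regular : ∀ {n} → ℕ → ℕ → WGraph n → Set
Regular a b G = (∀ i → degree (L G) i ≡ a) × (∀ i → degree (H G) i ≡ b)

Adj : ∀ {n} → WGraph n → Fin n → Fin n → Set
Adj G u v = (if L G u v then true else H G u v) ≡ true

ew : ∀ {n} → WGraph n → Fin n → Fin n → ℕ
ew G u v = if L G u v then 1 else (if H G u v then 2 else 0)

-- cyclic successor on Fin (suc k): i ↦ i+1 mod (k+1)
next : ∀ {k} → Fin (suc k) → Fin (suc k)
next {zero} zero = zero
next {suc k} zero = suc zero
next {suc k} (suc i) with next {k} i
... | zero = zero
... | suc j = suc (suc j)

record WCycle {n : ℕ} (G : WGraph n) : Set where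
  field
    m   : ℕ
    v   : Fin (3 + m) → Fin n
    inj : ∀ i j → v i ≡ v j → i ≡ j
    adj : ∀ i → Adj G (v i) (v (next i))

weight : ∀ {n} {G : WGraph n} → WCycle G → ℕ
weight {G = G} c = sum (map (λ i → ew G (v i) (v (next i))) (allFin (3 + m)))
  where open WCycle c

HasGirth : ∀ {n} → WGraph n → ℕ → Set
HasGirth G g = Σ (WCycle G) (λ c → weight c ≡ g) × (∀ (c : WCycle G) → g ≤ weight c)

IsABG : ∀ {n} → ℕ → ℕ → ℕ → WGraph n → Set
IsABG a b g G = Regular a b G × HasGirth G g

{-# OPTIONS --safe #-}
module Submission where

-- Every vertex is distinct from its a + b neighbours, so n ≥ a + b + 1.
-- If a b is odd then a and b are odd; n = a + b + 1 would then be odd, making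
-- the degree sum n a of the light graph odd, against the handshake lemma.

open import Defs
open import Data.Bool using (Bool; true; false; if_then_else_)
open import Data.Empty using (⊥)
open import Data.Fin using (Fin; zero; suc)
open import Data.List using (tabulate)
open import Data.List.Properties using (map-tabulate)
open import Data.Nat using (ℕ; zero; suc; _+_; _*_; _≤_; _<_; _%_; z≤n; s≤s; parity)
import Data.Nat.ListAction as List
open import Data.Nat.Properties
  using (+-0-commutativeMonoid; +-assoc; +-comm; +-suc; +-mono-≤; ≤∧≢⇒<; module ≤-Reasoning)
open import Data.Parity as ℙ using (0ℙ; 1ℙ)
open import Data.Parity.Properties using (+-homo-+; *-homo-*; p+p≡0ℙ)
open import Data.Product using (_×_; _,_)
open import Data.Vec.Functional using (Vector; removeAt)
open import Relation.Binary.PropositionalEquality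
  using (_≡_; refl; sym; trans; cong; cong₂; subst; module ≡-Reasoning)

open import Algebra.Properties.CommutativeMonoid.Sum +-0-commutativeMonoid
  using (sum; sum-syntax; ∑-distrib-+; sum-remove; sum-cong-≗)

sum-tabulate : ∀ {n} (f : Vector ℕ n) → List.sum (tabulate f) ≡ sum f
sum-tabulate {zero}  f = refl
sum-tabulate {suc n} f = cong (f zero +_) (sum-tabulate (λ j → f (suc j)))

∑-const : ∀ n x → ∑[ i < n ] x ≡ n * x
∑-const zero    x = refl
∑-const (suc n) x = cong (x +_) (∑-const n x)

∑≤n : ∀ {n} (f : Vector ℕ n) → (∀ j → f j ≤ 1) → sum f ≤ n
∑≤n {zero}  f f≤1 = z≤n
∑≤n {suc n} f f≤1 = +-mono-≤ (f≤1 zero) (∑≤n (λ j → f (suc j)) (λ j → f≤1 (suc j)))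

∑<n : ∀ {n} (f : Vector ℕ n) → (∀ j → f j ≤ 1) → (i : Fin n) → f i ≡ 0 → sum f < n
∑<n {suc n} f f≤1 i fi≡0 = s≤s (begin
  sum f                      ≡⟨ sum-remove f ⟩
  f i + sum (removeAt f i)   ≡⟨ cong (_+ sum (removeAt f i)) fi≡0 ⟩
  sum (removeAt f i)         ≤⟨ ∑≤n (removeAt f i) (λ j → f≤1 _) ⟩
  n                          ∎)
  where open ≤-Reasoning

-- Peeling off vertex 0 removes its row and its column, which have the same sum.
handshake : ∀ {n} (f : Fin n → Fin n → ℕ) → (∀ i j → f i j ≡ f j i) → (∀ i → f i i ≡ 0) →
            parity (∑[ i < n ] ∑[ j < n ] f i j) ≡ 0ℙ
handshake {zero}  f f-sym f-diag = refl
handshake {suc n} f f-sym f-diag = begin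
  parity ((f zero zero + row) + ∑[ i < n ] (f (suc i) zero + ∑[ j < n ] f′ i j))
    ≡⟨ cong parity (cong₂ _+_ (cong (_+ row) (f-diag zero))
                               (∑-distrib-+ (λ i → f (suc i) zero) (λ i → ∑[ j < n ] f′ i j))) ⟩
  parity (row + (column + rest))
    ≡⟨ cong (λ c → parity (row + (c + rest))) column≡row ⟩
  parity (row + (row + rest))
    ≡⟨ cong parity (sym (+-assoc row row rest)) ⟩
  parity (row + row + rest)
    ≡⟨ +-homo-+ (row + row) rest ⟩
  parity (row + row) ℙ.+ parity rest
    ≡⟨ cong₂ ℙ._+_ (trans (+-homo-+ row row) (p+p≡0ℙ (parity row)))
                   (handshake f′ (λ i j → f-sym (suc i) (suc j)) (λ i → f-diag (suc i))) ⟩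
  0ℙ ∎
  where
  open ≡-Reasoning
  f′ : Fin n → Fin n → ℕ
  f′ i j = f (suc i) (suc j)
  row column rest : ℕ
  row    = ∑[ j < n ] f zero (suc j)
  column = ∑[ i < n ] f (suc i) zero
  rest   = ∑[ i < n ] ∑[ j < n ] f′ i j
  column≡row : column ≡ row
  column≡row = sum-cong-≗ (λ i → f-sym (suc i) zero)

indicator : Bool → ℕ
indicator b = if b then 1 else 0

degree≡∑ : ∀ {n} (R : Fin n → Fin n → Bool) i → degree R i ≡ ∑[ j < n ] indicator (R i j)
degree≡∑ R i = trans (cong List.sum (map-tabulate (λ j → j) (λ j → indicator (R i j))))
                     (sum-tabulate (λ j → indicator (R i j)))

regular⇒even-degree-sum : ∀ {n a} (R : Fin n → Fin n → Bool) →
  (∀ i j → R i j ≡ R j i) → (∀ i → R i i ≡ false) → (∀ i → degree R i ≡ a) →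
  parity (n * a) ≡ 0ℙ
regular⇒even-degree-sum {n} {a} R R-sym R-irr R-reg = begin
  parity (n * a)                                         ≡⟨ cong parity (sym (∑-const n a)) ⟩
  parity (∑[ i < n ] a)                                  ≡⟨ cong parity (sum-cong-≗ λ i → trans (sym (R-reg i)) (degree≡∑ R i)) ⟩
  parity (∑[ i < n ] ∑[ j < n ] indicator (R i j))       ≡⟨ handshake _ (λ i j → cong indicator (R-sym i j)) (λ i → cong indicator (R-irr i)) ⟩
  0ℙ                                                     ∎
  where open ≡-Reasoning

indicator-disjoint : ∀ x y → (x ≡ true → y ≡ false) → indicator x + indicator y ≤ 1
indicator-disjoint true  y x⇒¬y rewrite x⇒¬y refl = s≤s z≤n
indicator-disjoint false true  x⇒¬y = s≤s z≤n
indicator-disjoint false false x⇒¬y = z≤n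

regular⇒degree<order : ∀ {n a b} (G : WGraph n) → Regular a b G → Fin n → a + b < n
regular⇒degree<order {n} {a} {b} G (L-reg , H-reg) v = subst (_< n) ∑≡a+b
  (∑<n (λ j → indicator (L G v j) + indicator (H G v j))
       (λ j → indicator-disjoint _ _ (disj G v j))
       v (cong₂ (λ x y → indicator x + indicator y) (L-irr G v) (H-irr G v)))
  where
  ∑≡a+b : ∑[ j < n ] (indicator (L G v j) + indicator (H G v j)) ≡ a + b
  ∑≡a+b = trans (∑-distrib-+ (λ j → indicator (L G v j)) (λ j → indicator (H G v j)))
                (cong₂ _+_ (trans (sym (degree≡∑ (L G) v)) (L-reg v))
                           (trans (sym (degree≡∑ (H G) v)) (H-reg v)))

odd⇒parity≡1ℙ : ∀ n → n % 2 ≡ 1 → parity n ≡ 1ℙ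
odd⇒parity≡1ℙ (suc zero)    _   = refl
odd⇒parity≡1ℙ (suc (suc n)) odd = odd⇒parity≡1ℙ n odd

odd-product⇒odd-factors : ∀ a b → (a * b) % 2 ≡ 1 → parity a ≡ 1ℙ × parity b ≡ 1ℙ
odd-product⇒odd-factors a b odd with parity a | parity b | trans (sym (*-homo-* a b)) (odd⇒parity≡1ℙ (a * b) odd)
... | 1ℙ | 1ℙ | _ = refl , refl

odd⇒[a+b+1]*a-odd : ∀ a b → parity a ≡ 1ℙ → parity b ≡ 1ℙ → parity ((a + b + 1) * a) ≡ 1ℙ
odd⇒[a+b+1]*a-odd a b a-odd b-odd = begin
  parity ((a + b + 1) * a)                       ≡⟨ *-homo-* (a + b + 1) a ⟩
  parity (a + b + 1) ℙ.* parity a                ≡⟨ cong (ℙ._* parity a) (+-homo-+ (a + b) 1) ⟩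
  (parity (a + b) ℙ.+ 1ℙ) ℙ.* parity a           ≡⟨ cong (λ p → (p ℙ.+ 1ℙ) ℙ.* parity a) (+-homo-+ a b) ⟩
  (parity a ℙ.+ parity b ℙ.+ 1ℙ) ℙ.* parity a    ≡⟨ cong₂ (λ p q → (p ℙ.+ q ℙ.+ 1ℙ) ℙ.* p) a-odd b-odd ⟩
  1ℙ                                             ∎
  where open ≡-Reasoning

-- The girth hypothesis only supplies a vertex: the empty wgraph is (a,b)-regular.
lemma1 : (a b g : ℕ) → 3 ≤ g → (n : ℕ) → (G : WGraph n) → IsABG a b g G →
           (a + b + 1 ≤ n) × ((a * b) % 2 ≡ 1 → a + b + 2 ≤ n)
lemma1 a b g _ n G (regular@(L-reg , _) , (cycle , _) , _) = a+b+1≤n , odd⇒a+b+2≤n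
  where
  a+b+1≤n : a + b + 1 ≤ n
  a+b+1≤n = subst (_≤ n) (+-comm 1 (a + b))
              (regular⇒degree<order G regular (WCycle.v cycle zero))

  odd⇒a+b+2≤n : (a * b) % 2 ≡ 1 → a + b + 2 ≤ n
  odd⇒a+b+2≤n odd = subst (_≤ n) (sym (+-suc (a + b) 1)) (≤∧≢⇒< a+b+1≤n a+b+1≢n)
    where
    a+b+1≢n : a + b + 1 ≡ n → ⊥
    a+b+1≢n refl with odd-product⇒odd-factors a b odd
    ... | a-odd , b-odd
      with trans (sym (odd⇒[a+b+1]*a-odd a b a-odd b-odd))
                 (regular⇒even-degree-sum (L G) (L-sym G) (L-irr G) L-reg)
    ... | ()
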